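{- Let $\mathbb{T}$ be a complete Elgot monad over a hyperextensive category $\mathbf{C}$, let $e:X\to T(Y+X)$ and $m:Z\to X$, and write $\bot_{A,B}=(\eta_{B+A}\circ\mathrm{inr}:A\to T(B+A))^{\dagger}:A\to TB$. Then: (1) if $e\circ m=\eta\circ\mathrm{inl}\circ u$ for some $u:Z\to Y$, then $e^{\dagger}\circ m=\eta\circ u$; (2) if $e\circ m=\bot_{Z,Y+X}$, then $e^{\dagger}\circ m=\bot_{Z,Y}$; (3) if $e\circ m=\eta\circ\mathrm{inr}\circ u$ for some $u:Z\to X$, then $e^{\dagger}\circ m=e^{\dagger}\circ u$; (4) if $e\circ m=\eta\circ\mathrm{inr}\circ m\circ u$ for some $u:Z\to Z$, then $e^{\dagger}\circ m=\bot_{Z,Y}$.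
   Context: A strong monad is a Kleisli triple $(T,\eta,(-)^{*})$ with strength $\tau$ satisfying the usual laws; $\mathrm{dist}$ is the inverse distributivity isomorphism. A complete Elgot monad is a strong monad with an operator assigning to every $f:X\to T(Y+X)$ a morphism $f^{\dagger}:X\to TY$ satisfying: unfolding $[\eta,f^{\dagger}]^{*}f=f^{\dagger}$; naturality $g^{*}f^{\dagger}=([T\mathrm{inl}\circ g,\eta\mathrm{inr}]^{*}f)^{\dagger}$; dinaturality $([\eta\mathrm{inl},h]^{*}g)^{\dagger}=[\eta,([\eta\mathrm{inl},g]^{*}h)^{\dagger}]^{*}g$; codiagonal $(T[\mathrm{id},\mathrm{inr}]g)^{\dagger}=(g^{\dagger})^{\dagger}$; uniformity ($f h=T(\mathrm{id}+h)g$ implies $f^{\dagger}h=g^{\dagger}$); strength compatibility $\tau(\mathrm{id}\times f^{\dagger})=(T\mathrm{dist}\circ\tau\circ(\mathrm{id}\times f))^{\dagger}$. A hyperextensive category has disjoint universal countable coproducts, and countable disjoint unions of coproduct-injection subobjects are coproduct injections. -}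

module Defs where

open import Level using (Level; _⊔_) renaming (suc to lsuc)
open import Data.Nat using (ℕ)
open import Data.Bool using (Bool; true; false)
open import Data.Product using (Σ; _×_; _,_; proj₁; proj₂)
open import Relation.Binary using (Rel; IsEquivalence)
open import Relation.Binary.PropositionalEquality using (_≡_)
open import Relation.Nullary using (¬_)

record Category (o ℓ e : Level) : Set (lsuc (o ⊔ ℓ ⊔ e)) where
  infix  4 _≈_
  infix  2 _⇒_
  infixr 9 _∘_
  field
    Obj : Set o
    _⇒_ : Obj → Obj → Set ℓ
    _≈_ : ∀ {A B} → Rel (A ⇒ B) e
    id  : ∀ {A} → A ⇒ A
    _∘_ : ∀ {A B C} → B ⇒ C → A ⇒ B → A ⇒ C
    equiv     : ∀ {A B} → IsEquivalence (_≈_ {A} {B})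
    ∘-resp-≈  : ∀ {A B C} {f h : B ⇒ C} {g i : A ⇒ B} →
                f ≈ h → g ≈ i → f ∘ g ≈ h ∘ i
    assoc     : ∀ {A B C D} {f : A ⇒ B} {g : B ⇒ C} {h : C ⇒ D} →
                (h ∘ g) ∘ f ≈ h ∘ (g ∘ f)
    identityˡ : ∀ {A B} {f : A ⇒ B} → id ∘ f ≈ f
    identityʳ : ∀ {A B} {f : A ⇒ B} → f ∘ id ≈ f

module Notions {o ℓ e} (C : Category o ℓ e) where
  open Category C

  Mono : ∀ {A B} → A ⇒ B → Set (o ⊔ ℓ ⊔ e)
  Mono {A} f = ∀ {X} (g h : X ⇒ A) → f ∘ g ≈ f ∘ h → g ≈ h

  IsIso : ∀ {A B} → A ⇒ B → Set (ℓ ⊔ e)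
  IsIso {A} {B} f = Σ (B ⇒ A) λ g → (g ∘ f ≈ id) × (f ∘ g ≈ id)

  IsInitial : Obj → Set (o ⊔ ℓ ⊔ e)
  IsInitial I = ∀ X → Σ (I ⇒ X) λ h → ∀ (h' : I ⇒ X) → h' ≈ h

  IsPullback : ∀ {A B D P} (f : A ⇒ D) (g : B ⇒ D) (p : P ⇒ A) (q : P ⇒ B) →
               Set (o ⊔ ℓ ⊔ e)
  IsPullback {A} {B} {D} {P} f g p q =
    (f ∘ p ≈ g ∘ q) ×
    (∀ {X} (x : X ⇒ A) (y : X ⇒ B) → f ∘ x ≈ g ∘ y →
       Σ (X ⇒ P) λ h → ((p ∘ h ≈ x) × (q ∘ h ≈ y)) ×
         (∀ (h' : X ⇒ P) → p ∘ h' ≈ x → q ∘ h' ≈ y → h' ≈ h))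

  IsCoproduct : (I : Set) (A : I → Obj) (U : Obj) (ι : ∀ i → A i ⇒ U) →
                Set (o ⊔ ℓ ⊔ e)
  IsCoproduct I A U ι =
    ∀ X (f : ∀ i → A i ⇒ X) →
      Σ (U ⇒ X) λ h → (∀ i → h ∘ ι i ≈ f i) ×
        (∀ (h' : U ⇒ X) → (∀ i → h' ∘ ι i ≈ f i) → h' ≈ h)

  Countable : Set → Set
  Countable I = Σ (I → ℕ) λ c → ∀ i j → c i ≡ c j → i ≡ j

  IsSummand : ∀ {A B} → A ⇒ B → Set (o ⊔ ℓ ⊔ e)
  IsSummand {A} {B} s =
    Σ Obj λ K → Σ (K ⇒ B) λ k →
      IsCoproduct Bool (λ { true → A ; false → K }) B
                  (λ { true → s ; false → k })

  DisjointMaps : ∀ {A B D} → A ⇒ D → B ⇒ D → Set (o ⊔ ℓ ⊔ e)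
  DisjointMaps {A} {B} f g =
    Σ Obj λ P → Σ (P ⇒ A) λ p → Σ (P ⇒ B) λ q →
      IsPullback f g p q × IsInitial P

record Hyperextensive {o ℓ e} (C : Category o ℓ e) : Set (lsuc (o ⊔ ℓ ⊔ e)) where
  open Category C
  open Notions C
  field
    coproducts : ∀ (I : Set) → Countable I → (A : I → Obj) →
      Σ Obj λ U → Σ (∀ i → A i ⇒ U) λ ι → IsCoproduct I A U ι
    disjoint-mono : ∀ (I : Set) → Countable I → (A : I → Obj) (U : Obj)
      (ι : ∀ i → A i ⇒ U) → IsCoproduct I A U ι → ∀ i → Mono (ι i)
    disjoint-init : ∀ (I : Set) → Countable I → (A : I → Obj) (U : Obj)
      (ι : ∀ i → A i ⇒ U) → IsCoproduct I A U ι →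
      ∀ i j → ¬ (i ≡ j) → DisjointMaps (ι i) (ι j)
    universal-exists : ∀ (I : Set) → Countable I → (A : I → Obj) (U : Obj)
      (ι : ∀ i → A i ⇒ U) → IsCoproduct I A U ι →
      ∀ {B} (f : B ⇒ U) i →
      Σ Obj λ P → Σ (P ⇒ B) λ p → Σ (P ⇒ A i) λ q → IsPullback f (ι i) p q
    universal-stable : ∀ (I : Set) → Countable I → (A : I → Obj) (U : Obj)
      (ι : ∀ i → A i ⇒ U) → IsCoproduct I A U ι →
      ∀ {B} (f : B ⇒ U) (P : I → Obj) (p : ∀ i → P i ⇒ B)
      (q : ∀ i → P i ⇒ A i) → (∀ i → IsPullback f (ι i) (p i) (q i)) →
      IsCoproduct I P B p
    unions : ∀ (I : Set) → Countable I → (A : I → Obj) (B : Obj)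
      (s : ∀ i → A i ⇒ B) → (∀ i → IsSummand (s i)) →
      (∀ i j → ¬ (i ≡ j) → DisjointMaps (s i) (s j)) →
      ∀ (U : Obj) (κ : ∀ i → A i ⇒ U) → IsCoproduct I A U κ →
      ∀ (u : U ⇒ B) → (∀ i → u ∘ κ i ≈ s i) → IsSummand u

record BinaryCoproducts {o ℓ e} (C : Category o ℓ e) : Set (o ⊔ ℓ ⊔ e) where
  open Category C
  infixr 6 _+_
  field
    _+_ : Obj → Obj → Obj
    inl : ∀ {A B} → A ⇒ A + B
    inr : ∀ {A B} → B ⇒ A + B
    [_,_] : ∀ {A B X} → A ⇒ X → B ⇒ X → A + B ⇒ X
    inject₁ : ∀ {A B X} {f : A ⇒ X} {g : B ⇒ X} → [ f , g ] ∘ inl ≈ f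
    inject₂ : ∀ {A B X} {f : A ⇒ X} {g : B ⇒ X} → [ f , g ] ∘ inr ≈ g
    unique  : ∀ {A B X} {f : A ⇒ X} {g : B ⇒ X} {h : A + B ⇒ X} →
              h ∘ inl ≈ f → h ∘ inr ≈ g → h ≈ [ f , g ]

  infixr 7 _+₁_
  _+₁_ : ∀ {A B A' B'} → A ⇒ A' → B ⇒ B' → A + B ⇒ A' + B'
  f +₁ g = [ inl ∘ f , inr ∘ g ]

record BinaryProducts {o ℓ e} (C : Category o ℓ e) : Set (o ⊔ ℓ ⊔ e) where
  open Category C
  infixr 7 _×ₒ_
  field
    _×ₒ_ : Obj → Obj → Obj
    π₁ : ∀ {A B} → A ×ₒ B ⇒ A
    π₂ : ∀ {A B} → A ×ₒ B ⇒ B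
    ⟨_,_⟩ : ∀ {A B X} → X ⇒ A → X ⇒ B → X ⇒ A ×ₒ B
    project₁ : ∀ {A B X} {f : X ⇒ A} {g : X ⇒ B} → π₁ ∘ ⟨ f , g ⟩ ≈ f
    project₂ : ∀ {A B X} {f : X ⇒ A} {g : X ⇒ B} → π₂ ∘ ⟨ f , g ⟩ ≈ g
    unique   : ∀ {A B X} {f : X ⇒ A} {g : X ⇒ B} {h : X ⇒ A ×ₒ B} →
               π₁ ∘ h ≈ f → π₂ ∘ h ≈ g → h ≈ ⟨ f , g ⟩

  infixr 8 _⁂_
  _⁂_ : ∀ {A B A' B'} → A ⇒ A' → B ⇒ B' → A ×ₒ B ⇒ A' ×ₒ B'
  f ⁂ g = ⟨ f ∘ π₁ , g ∘ π₂ ⟩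

  assocʳ : ∀ {A B D} → (A ×ₒ B) ×ₒ D ⇒ A ×ₒ (B ×ₒ D)
  assocʳ = ⟨ π₁ ∘ π₁ , ⟨ π₂ ∘ π₁ , π₂ ⟩ ⟩

record StrongMonad {o ℓ e} (C : Category o ℓ e)
  (cp : BinaryCoproducts C) (pr : BinaryProducts C) : Set (o ⊔ ℓ ⊔ e) where
  open Category C
  open BinaryCoproducts cp
  open BinaryProducts pr
  field
    T   : Obj → Obj
    η   : ∀ {A} → A ⇒ T A
    _*  : ∀ {A B} → A ⇒ T B → T A ⇒ T B
    *-resp-≈ : ∀ {A B} {f g : A ⇒ T B} → f ≈ g → f * ≈ g *
    η*   : ∀ {A} → (η {A}) * ≈ id
    *-η  : ∀ {A B} {f : A ⇒ T B} → f * ∘ η ≈ f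
    *-*  : ∀ {A B D} {f : A ⇒ T B} {g : B ⇒ T D} → (g * ∘ f) * ≈ g * ∘ f *

  T₁ : ∀ {A B} → A ⇒ B → T A ⇒ T B
  T₁ f = (η ∘ f) *

  field
    τ : ∀ {A B} → A ×ₒ T B ⇒ T (A ×ₒ B)
    τ-natural : ∀ {A A' B B'} {f : A ⇒ A'} {g : B ⇒ B'} →
                τ ∘ (f ⁂ T₁ g) ≈ T₁ (f ⁂ g) ∘ τ
    τ-π₂  : ∀ {A B} → T₁ π₂ ∘ τ {A} {B} ≈ π₂
    τ-assoc : ∀ {A B D} →
              T₁ assocʳ ∘ τ {A ×ₒ B} {D} ≈ τ ∘ (id ⁂ τ) ∘ assocʳ
    τ-η   : ∀ {A B} → τ ∘ (id ⁂ η) ≈ η {A ×ₒ B}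
    τ-*   : ∀ {A B D} {f : B ⇒ T D} →
            τ ∘ (id {A} ⁂ f *) ≈ (τ ∘ (id ⁂ f)) * ∘ τ
    dist : ∀ {A B D} → A ×ₒ (B + D) ⇒ (A ×ₒ B) + (A ×ₒ D)
    dist-inverseˡ : ∀ {A B D} → dist ∘ [ id ⁂ inl , id ⁂ inr ] ≈ id {(A ×ₒ B) + (A ×ₒ D)}
    dist-inverseʳ : ∀ {A B D} → [ id ⁂ inl , id ⁂ inr ] ∘ dist ≈ id {A ×ₒ (B + D)}

record CompleteElgot {o ℓ e} (C : Category o ℓ e)
  (cp : BinaryCoproducts C) (pr : BinaryProducts C)
  (M : StrongMonad C cp pr) : Set (o ⊔ ℓ ⊔ e) where
  open Category C
  open BinaryCoproducts cp
  open BinaryProducts pr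
  open StrongMonad M
  field
    _† : ∀ {X Y} → X ⇒ T (Y + X) → X ⇒ T Y
    †-resp-≈ : ∀ {X Y} {f g : X ⇒ T (Y + X)} → f ≈ g → f † ≈ g †
    †-unfolding : ∀ {X Y} {f : X ⇒ T (Y + X)} → [ η , f † ] * ∘ f ≈ f †
    naturality : ∀ {X Y Z} {f : X ⇒ T (Y + X)} {g : Y ⇒ T Z} →
      g * ∘ f † ≈ ([ T₁ inl ∘ g , η ∘ inr ] * ∘ f) †
    dinaturality : ∀ {X Y Z} {g : X ⇒ T (Y + Z)} {h : Z ⇒ T (Y + X)} →
      ([ η ∘ inl , h ] * ∘ g) † ≈ [ η , ([ η ∘ inl , g ] * ∘ h) † ] * ∘ g
    codiagonal : ∀ {X Y} {g : X ⇒ T ((Y + X) + X)} →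
      (T₁ [ id , inr ] ∘ g) † ≈ (g †) †
    uniformity : ∀ {X Y Z} {f : X ⇒ T (Y + X)} {g : Z ⇒ T (Y + Z)}
      {h : Z ⇒ X} → f ∘ h ≈ T₁ (id +₁ h) ∘ g → f † ∘ h ≈ g †
    strength : ∀ {W X Y} {f : X ⇒ T (Y + X)} →
      τ ∘ (id {W} ⁂ f †) ≈ (T₁ dist ∘ τ ∘ (id ⁂ f)) †

  ⊥ : ∀ {A B} → A ⇒ T B
  ⊥ {A} {B} = (η {B + A} ∘ inr) †

-- The proof only uses the Kleisli laws and the unfolding, naturality and
-- uniformity axioms of the iteration operator.
module Submission where

open import Defs
open import Level using (Level)
open import Data.Product using (_×_; _,_)
open import Relation.Binary using (IsEquivalence; Setoid)
import Relation.Binary.Reasoning.Setoid as SetoidReasoning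

module ElgotFacts {o ℓ e : Level} (C : Category o ℓ e)
    (cp : BinaryCoproducts C) (pr : BinaryProducts C)
    (M : StrongMonad C cp pr) (E : CompleteElgot C cp pr M) where
  open Category C
  open BinaryCoproducts cp
  open StrongMonad M
  open CompleteElgot E

  module Eq {A B} = IsEquivalence (equiv {A} {B})

  hom : Obj → Obj → Setoid _ _
  hom A B = record { Carrier = A ⇒ B ; _≈_ = _≈_ ; isEquivalence = equiv }

  *-after-η : ∀ {A B D} (a : A ⇒ T B) (w : D ⇒ A) → a * ∘ (η ∘ w) ≈ a ∘ w
  *-after-η {B = B} {D} a w = begin
      a * ∘ (η ∘ w)   ≈⟨ Eq.sym assoc ⟩
      (a * ∘ η) ∘ w   ≈⟨ ∘-resp-≈ *-η Eq.refl ⟩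
      a ∘ w           ∎
    where open SetoidReasoning (hom D (T B))

  -- Renaming the state along h commutes with the pure "continue" step;
  -- this is the square that uniformity asks for.
  continue-rename : ∀ {Y A B} (h : A ⇒ B) →
                    T₁ (id {Y} +₁ h) ∘ (η ∘ inr) ≈ (η ∘ inr) ∘ h
  continue-rename {Y} {A} {B} h = begin
      T₁ (id +₁ h) ∘ (η ∘ inr)  ≈⟨ *-after-η (η ∘ (id +₁ h)) inr ⟩
      (η ∘ (id +₁ h)) ∘ inr     ≈⟨ assoc ⟩
      η ∘ ((id +₁ h) ∘ inr)     ≈⟨ ∘-resp-≈ Eq.refl inject₂ ⟩
      η ∘ (inr ∘ h)             ≈⟨ Eq.sym assoc ⟩
      (η ∘ inr) ∘ h             ∎
    where open SetoidReasoning (hom A (T (Y + B)))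

  continue-rename-at : ∀ {Y A B D} (h : A ⇒ B) (w : D ⇒ A) →
                       T₁ (id {Y} +₁ h) ∘ (η ∘ inr ∘ w) ≈ η ∘ inr ∘ h ∘ w
  continue-rename-at {Y} {B = B} {D} h w = begin
      T₁ (id +₁ h) ∘ (η ∘ inr ∘ w)    ≈⟨ ∘-resp-≈ Eq.refl (Eq.sym assoc) ⟩
      T₁ (id +₁ h) ∘ ((η ∘ inr) ∘ w)  ≈⟨ Eq.sym assoc ⟩
      (T₁ (id +₁ h) ∘ (η ∘ inr)) ∘ w  ≈⟨ ∘-resp-≈ (continue-rename h) Eq.refl ⟩
      ((η ∘ inr) ∘ h) ∘ w             ≈⟨ assoc ⟩
      (η ∘ inr) ∘ h ∘ w               ≈⟨ assoc ⟩
      η ∘ inr ∘ h ∘ w                 ∎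
    where open SetoidReasoning (hom D (T (Y + B)))

  unfold-at : ∀ {X Y Z} (f : X ⇒ T (Y + X)) (m : Z ⇒ X) →
              f † ∘ m ≈ [ η , f † ] * ∘ (f ∘ m)
  unfold-at f m = Eq.trans (∘-resp-≈ (Eq.sym †-unfolding) Eq.refl) assoc

  †-pure-step : ∀ {X Y Z} (f : X ⇒ T (Y + X)) (m : Z ⇒ X) (w : Z ⇒ Y + X) →
                f ∘ m ≈ η ∘ w → f † ∘ m ≈ [ η , f † ] ∘ w
  †-pure-step {Y = Y} {Z} f m w step = begin
      f † ∘ m                  ≈⟨ unfold-at f m ⟩
      [ η , f † ] * ∘ (f ∘ m)  ≈⟨ ∘-resp-≈ Eq.refl step ⟩
      [ η , f † ] * ∘ (η ∘ w)  ≈⟨ *-after-η [ η , f † ] w ⟩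
      [ η , f † ] ∘ w          ∎
    where open SetoidReasoning (hom Z (T Y))

  †-terminating-step : ∀ {X Y Z} (f : X ⇒ T (Y + X)) (m : Z ⇒ X) (u : Z ⇒ Y) →
                       f ∘ m ≈ η ∘ inl ∘ u → f † ∘ m ≈ η ∘ u
  †-terminating-step f m u step =
    Eq.trans (†-pure-step f m (inl ∘ u) step)
             (Eq.trans (Eq.sym assoc) (∘-resp-≈ inject₁ Eq.refl))

  †-continuing-step : ∀ {X Y Z} (f : X ⇒ T (Y + X)) (m : Z ⇒ X) (u : Z ⇒ X) →
                      f ∘ m ≈ η ∘ inr ∘ u → f † ∘ m ≈ f † ∘ u
  †-continuing-step f m u step =
    Eq.trans (†-pure-step f m (inr ∘ u) step)
             (Eq.trans (Eq.sym assoc) (∘-resp-≈ inject₂ Eq.refl))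

  ⊥-absorbs-right : ∀ {A B Y} (h : A ⇒ B) → ⊥ {B} {Y} ∘ h ≈ ⊥ {A} {Y}
  ⊥-absorbs-right h = uniformity (Eq.sym (continue-rename h))

  ⊥-absorbs-left : ∀ {A B D} (g : B ⇒ T D) → g * ∘ ⊥ {A} {B} ≈ ⊥ {A} {D}
  ⊥-absorbs-left {A} {B} {D} g = begin
      g * ∘ (η ∘ inr) †                            ≈⟨ naturality ⟩
      ([ T₁ inl ∘ g , η ∘ inr ] * ∘ (η ∘ inr)) †  ≈⟨ †-resp-≈ (*-after-η _ inr) ⟩
      ([ T₁ inl ∘ g , η ∘ inr ] ∘ inr) †          ≈⟨ †-resp-≈ inject₂ ⟩
      (η ∘ inr) †                                  ∎
    where open SetoidReasoning (hom A (T D))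

  †-diverging-step : ∀ {X Y Z} (f : X ⇒ T (Y + X)) (m : Z ⇒ X) →
                     f ∘ m ≈ ⊥ {Z} {Y + X} → f † ∘ m ≈ ⊥ {Z} {Y}
  †-diverging-step f m step =
    Eq.trans (unfold-at f m)
             (Eq.trans (∘-resp-≈ Eq.refl step) (⊥-absorbs-left [ η , f † ]))

  renaming-loop-diverges : ∀ {Y Z} (u : Z ⇒ Z) →
                           (η ∘ inr ∘ u) † ≈ ⊥ {Z} {Y}
  renaming-loop-diverges {Y} {Z} u = begin
      loop †                ≈⟨ Eq.sym (uniformity loop-is-continue) ⟩
      ⊥ {T Y} {Y} ∘ loop †  ≈⟨ ⊥-absorbs-right (loop †) ⟩
      ⊥                     ∎
    where
      open SetoidReasoning (hom Z (T Y))
      loop : Z ⇒ T (Y + Z)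
      loop = η ∘ inr ∘ u
      loop-invariant : loop † ∘ u ≈ loop †
      loop-invariant = uniformity (Eq.trans (Eq.trans assoc (∘-resp-≈ Eq.refl assoc))
                                            (Eq.sym (continue-rename-at u u)))
      loop-is-continue : (η ∘ inr) ∘ loop † ≈ T₁ (id +₁ loop †) ∘ loop
      loop-is-continue = Eq.trans assoc
        (Eq.trans (∘-resp-≈ Eq.refl (∘-resp-≈ Eq.refl (Eq.sym loop-invariant)))
                  (Eq.sym (continue-rename-at (loop †) u)))

  †-self-loop : ∀ {X Y Z} (f : X ⇒ T (Y + X)) (m : Z ⇒ X) (u : Z ⇒ Z) →
                f ∘ m ≈ η ∘ inr ∘ m ∘ u → f † ∘ m ≈ ⊥ {Z} {Y}
  †-self-loop f m u step =
    Eq.trans (uniformity (Eq.trans step (Eq.sym (continue-rename-at m u))))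
             (renaming-loop-diverges u)

lemma6p12 : ∀ {o ℓ e : Level} (C : Category o ℓ e) → Hyperextensive C →
    (cp : BinaryCoproducts C) (pr : BinaryProducts C)
    (M : StrongMonad C cp pr) (E : CompleteElgot C cp pr M) →
    let open Category C
        open BinaryCoproducts cp
        open StrongMonad M
        open CompleteElgot E
    in ∀ {X Y Z} (e : X ⇒ T (Y + X)) (m : Z ⇒ X) →
      (∀ (u : Z ⇒ Y) → e ∘ m ≈ η ∘ inl ∘ u → e † ∘ m ≈ η ∘ u)
      × (e ∘ m ≈ ⊥ {Z} {Y + X} → e † ∘ m ≈ ⊥ {Z} {Y})
      × (∀ (u : Z ⇒ X) → e ∘ m ≈ η ∘ inr ∘ u → e † ∘ m ≈ e † ∘ u)
      × (∀ (u : Z ⇒ Z) → e ∘ m ≈ η ∘ inr ∘ m ∘ u → e † ∘ m ≈ ⊥ {Z} {Y})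
lemma6p12 C _ cp pr M E e m =
  †-terminating-step e m , †-diverging-step e m ,
  †-continuing-step e m , †-self-loop e m
  where open ElgotFacts C cp pr M E
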